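{- Let $G$ be a connected bipartite graph of order at least $4$ with stable sets $U$ and $W$, $|U|=r\le s=|W|$. If $1\le r\le 2$, then $\lambda(\overline{G})\le\lambda(G)$.
   Context: A set $S$ of vertices is distinguishing if $N(x)\cap S\neq N(y)\cap S$ for all distinct vertices $x,y\notin S$ ($N$ = open neighborhood); a locating-dominating set is a distinguishing set $S$ such that every vertex not in $S$ has a neighbor in $S$. $\lambda(G)$ is the minimum cardinality of a locating-dominating set of $G$, and $\overline{G}$ is the complement of $G$. -}

module Defs where

open import Data.Nat using (ℕ; _≤_)
open import Data.Bool using (Bool; true; false; not; if_then_else_)
open import Data.Fin using (Fin; _≟_)
open import Data.Fin.Subset using (Subset; _∈_; _∉_; ∣_∣; ∁)
open import Data.Product using (Σ; ∃; _×_; _,_)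
open import Relation.Nullary using (¬_; does)
open import Relation.Binary.PropositionalEquality using (_≡_; _≢_)

record Graph (n : ℕ) : Set where
  field
    adj   : Fin n → Fin n → Bool
    sym   : ∀ x y → adj x y ≡ adj y x
    irrefl : ∀ x → adj x x ≡ false
open Graph public

Adj : ∀ {n} → Graph n → Fin n → Fin n → Set
Adj G x y = adj G x y ≡ true

complement : ∀ {n} → Graph n → Graph n
complement {n} G = record { adj = a ; sym = s ; irrefl = i }
  where
  a : Fin n → Fin n → Bool
  a x y = if does (x ≟ y) then false else not (adj G x y)
  s : ∀ x y → a x y ≡ a y x
  s x y with x ≟ y | y ≟ x
  ... | Relation.Nullary.yes _ | Relation.Nullary.yes _ = Relation.Binary.PropositionalEquality.refl
  ... | Relation.Nullary.yes p | Relation.Nullary.no q = Data.Empty.⊥-elim (q (Relation.Binary.PropositionalEquality.sym p))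
    where import Data.Empty
  ... | Relation.Nullary.no q | Relation.Nullary.yes p = Data.Empty.⊥-elim (q (Relation.Binary.PropositionalEquality.sym p))
    where import Data.Empty
  ... | Relation.Nullary.no _ | Relation.Nullary.no _ =
    Relation.Binary.PropositionalEquality.cong not (sym G x y)
  i : ∀ x → a x x ≡ false
  i x with x ≟ x
  ... | Relation.Nullary.yes _ = Relation.Binary.PropositionalEquality.refl
  ... | Relation.Nullary.no q = Data.Empty.⊥-elim (q Relation.Binary.PropositionalEquality.refl)
    where import Data.Empty

data Walk {n : ℕ} (G : Graph n) : Fin n → Fin n → Set where
  here : ∀ {x} → Walk G x x
  step : ∀ {x y z} → Adj G x y → Walk G y z → Walk G x z

Connected : ∀ {n} → Graph n → Set
Connected G = ∀ x y → Walk G x y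

Stable : ∀ {n} → Graph n → Subset n → Set
Stable G S = ∀ x y → x ∈ S → y ∈ S → ¬ Adj G x y

IsBipartition : ∀ {n} → Graph n → Subset n → Set
IsBipartition G U = Stable G U × Stable G (∁ U)

SameTrace : ∀ {n} → Graph n → Subset n → Fin n → Fin n → Set
SameTrace G S x y = ∀ z → z ∈ S → (Adj G x z → Adj G y z) × (Adj G y z → Adj G x z)

Distinguishing : ∀ {n} → Graph n → Subset n → Set
Distinguishing G S = ∀ x y → x ∉ S → y ∉ S → x ≢ y → ¬ SameTrace G S x y

Dominating : ∀ {n} → Graph n → Subset n → Set
Dominating G S = ∀ x → x ∉ S → ∃ λ z → z ∈ S × Adj G x z

LocatingDominating : ∀ {n} → Graph n → Subset n → Set
LocatingDominating G S = Distinguishing G S × Dominating G S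

IsLDNumber : ∀ {n} → Graph n → ℕ → Set
IsLDNumber G k =
  (Σ _ λ S → LocatingDominating G S × ∣ S ∣ ≡ k) ×
  (∀ S → LocatingDominating G S → k ≤ ∣ S ∣)

-- If some vertex x outside a locating-dominating set T of G is adjacent to all of T, then in a
-- bipartite G the set T is exactly the side opposite to x. Since |U| ≤ 2, exchanging a suitable
-- vertex of T for x yields a set of the same size that still distinguishes the vertices outside
-- it and leaves each of them with a non-neighbour inside it; if there is no such x, T itself has
-- this property. Distinguishing is insensitive to complementation, and a non-neighbour in G is a
-- neighbour in the complement, so either set is locating-dominating in the complement.
module Submission where

open import Defs hiding (sym)
open import Data.Nat using (ℕ; suc; _≤_; z≤n; s≤s)
open import Data.Nat.Properties using (≤-trans; <⇒≱; ∸-mono)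
open import Data.Bool using (true; not)
open import Data.Bool.Properties using (¬-not) renaming (_≟_ to _≟ᵇ_)
open import Data.Fin using (Fin; zero; suc; _≟_)
open import Data.Fin.Properties using (any?; all?; ¬∀⟶∃¬)
open import Data.Fin.Subset using (Subset; inside; outside; _∈_; _∉_; _⊆_; ∁; ⁅_⁆; _-_; ∣_∣)
open import Data.Fin.Subset.Properties
  using (_∈?_; x∈p∧x≢y⇒x∈p-y; x∈p⇒∣p-x∣<∣p∣; p⊆q⇒∣p∣≤∣q∣; ∣⁅x⁆∣≡1; x∈⁅x⁆;
         x∉p⇒x∈∁p; x∉∁p⇒x∈p; x∈∁p⇒x∉p; ∣∁p∣≡n∸∣p∣)
open import Data.Vec using (Vec; lookup; _∷_; _[_]=_; here; there; _[_]≔_)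
open import Data.Vec.Properties using ([]=-injective; []≔-updates; []≔-minimal; lookup⇒[]=)
open import Data.Product using (∃; _×_; _,_; proj₁; proj₂)
open import Data.Sum using (_⊎_; inj₁; inj₂)
open import Function using (_∘_)
open import Relation.Nullary using (¬_; Dec; yes; no; contradiction; ¬?)
open import Relation.Nullary.Decidable using (_×-dec_; _→-dec_; decidable-stable)
open import Relation.Binary.PropositionalEquality using (_≡_; _≢_; refl; sym; trans; cong; subst)

private variable
  n : ℕ

[]≔-minimal⁻ : ∀ {a} {A : Set a} {x y : A} (xs : Vec A n) (i j : Fin n) → i ≢ j →
               (xs [ j ]≔ y) [ i ]= x → xs [ i ]= x
[]≔-minimal⁻ xs i j i≢j xs′[i]=x =
  subst (xs [ i ]=_) ([]=-injective ([]≔-minimal xs i j i≢j xs[i]) xs′[i]=x) xs[i]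
  where
  xs[i] : xs [ i ]= lookup xs i
  xs[i] = lookup⇒[]= i xs refl

∣p[x]≔inside∣≡1+∣p∣ : (p : Subset n) {x : Fin n} → x ∉ p → ∣ p [ x ]≔ inside ∣ ≡ suc ∣ p ∣
∣p[x]≔inside∣≡1+∣p∣ (inside  ∷ p) {zero}  x∉p = contradiction here x∉p
∣p[x]≔inside∣≡1+∣p∣ (outside ∷ p) {zero}  x∉p = refl
∣p[x]≔inside∣≡1+∣p∣ (inside  ∷ p) {suc x} x∉p = cong suc (∣p[x]≔inside∣≡1+∣p∣ p (x∉p ∘ there))
∣p[x]≔inside∣≡1+∣p∣ (outside ∷ p) {suc x} x∉p = ∣p[x]≔inside∣≡1+∣p∣ p (x∉p ∘ there)

1+∣p[x]≔outside∣≡∣p∣ : (p : Subset n) {x : Fin n} → x ∈ p → suc ∣ p [ x ]≔ outside ∣ ≡ ∣ p ∣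
1+∣p[x]≔outside∣≡∣p∣ (inside  ∷ p) {zero}  here        = refl
1+∣p[x]≔outside∣≡∣p∣ (inside  ∷ p) {suc x} (there x∈p) = cong suc (1+∣p[x]≔outside∣≡∣p∣ p x∈p)
1+∣p[x]≔outside∣≡∣p∣ (outside ∷ p) {suc x} (there x∈p) = 1+∣p[x]≔outside∣≡∣p∣ p x∈p

x∉p∧y∈p⇒x≢y : {p : Subset n} {x y : Fin n} → x ∉ p → y ∈ p → x ≢ y
x∉p∧y∈p⇒x≢y x∉p y∈p refl = x∉p y∈p

∣p∣≤2⇒x≡y⊎x≡z : {p : Subset n} {x y z : Fin n} →
                ∣ p ∣ ≤ 2 → y ∈ p → z ∈ p → y ≢ z → x ∈ p → x ≡ y ⊎ x ≡ z
∣p∣≤2⇒x≡y⊎x≡z {n} {p} {x} {y} {z} ∣p∣≤2 y∈p z∈p y≢z x∈p with x ≟ y | x ≟ z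
... | yes x≡y | _        = inj₁ x≡y
... | no _    | yes x≡z  = inj₂ x≡z
... | no x≢y  | no x≢z   = contradiction ∣p∣≤2 (<⇒≱ 3≤∣p∣)
  where
  grow : ∀ {k} {q : Subset n} {v : Fin n} → k ≤ ∣ q - v ∣ → v ∈ q → suc k ≤ ∣ q ∣
  grow k≤∣q-v∣ v∈q = ≤-trans (s≤s k≤∣q-v∣) (x∈p⇒∣p-x∣<∣p∣ v∈q)
  3≤∣p∣ : 3 ≤ ∣ p ∣
  3≤∣p∣ = grow (grow (grow z≤n (x∈p∧x≢y⇒x∈p-y (x∈p∧x≢y⇒x∈p-y x∈p x≢y) x≢z))
                     (x∈p∧x≢y⇒x∈p-y z∈p (y≢z ∘ sym)))
               y∈p

2≤∣p∣⇒∃x∈p∧x≢y : (p : Subset n) → 2 ≤ ∣ p ∣ → ∀ y → ∃ λ x → x ∈ p × x ≢ y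
2≤∣p∣⇒∃x∈p∧x≢y p 2≤∣p∣ y with any? (λ x → x ∈? p ×-dec ¬? (x ≟ y))
... | yes found = found
... | no none   = contradiction (subst (∣ p ∣ ≤_) (∣⁅x⁆∣≡1 y) (p⊆q⇒∣p∣≤∣q∣ p⊆⁅y⁆)) (<⇒≱ 2≤∣p∣)
  where
  p⊆⁅y⁆ : p ⊆ ⁅ y ⁆
  p⊆⁅y⁆ {x} x∈p with x ≟ y
  ... | yes refl = x∈⁅x⁆ y
  ... | no x≢y   = contradiction (x , x∈p , x≢y) none

exchange : Subset n → Fin n → Fin n → Subset n
exchange p w x = (p [ w ]≔ outside) [ x ]≔ inside

module _ (p : Subset n) {w x : Fin n} where

  x∈exchange : x ∈ exchange p w x
  x∈exchange = []≔-updates _ x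

  exchange-∈⁺ : ∀ {y} → y ≢ w → y ≢ x → y ∈ p → y ∈ exchange p w x
  exchange-∈⁺ {y} y≢w y≢x y∈p = []≔-minimal _ y x y≢x ([]≔-minimal p y w y≢w y∈p)

  ∣exchange∣ : w ∈ p → x ∉ p → ∣ exchange p w x ∣ ≡ ∣ p ∣
  ∣exchange∣ w∈p x∉p =
    trans (∣p[x]≔inside∣≡1+∣p∣ _ (x∉p ∘ []≔-minimal⁻ p x w (x∉p∧y∈p⇒x≢y x∉p w∈p)))
          (1+∣p[x]≔outside∣≡∣p∣ p w∈p)

adj? : (G : Graph n) → ∀ x y → Dec (Adj G x y)
adj? G x y = adj G x y ≟ᵇ true

adj-complement : (G : Graph n) {x y : Fin n} → x ≢ y → adj (complement G) x y ≡ not (adj G x y)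
adj-complement G {x} {y} x≢y with x ≟ y
... | yes x≡y = contradiction x≡y x≢y
... | no _    = refl

Adj-complement⁺ : (G : Graph n) {x y : Fin n} → x ≢ y → ¬ Adj G x y → Adj (complement G) x y
Adj-complement⁺ G x≢y ¬x~y = trans (adj-complement G x≢y) (cong not (¬-not ¬x~y))

Adj-complement⁻ : (G : Graph n) {x y : Fin n} → x ≢ y → Adj (complement G) x y → ¬ Adj G x y
Adj-complement⁻ G x≢y x~ᶜy x~y
  with trans (cong not (sym x~y)) (trans (sym (adj-complement G x≢y)) x~ᶜy)
... | ()

Distinguishing-complement : (G : Graph n) {S : Subset n} →
                            Distinguishing G S → Distinguishing (complement G) S
Distinguishing-complement G {S} dist x y x∉S y∉S x≢y same =
  dist x y x∉S y∉S x≢y λ t t∈S →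
    reflect y∉S x∉S t∈S (proj₂ (same t t∈S)) , reflect x∉S y∉S t∈S (proj₁ (same t t∈S))
  where
  reflect : ∀ {u v t} → u ∉ S → v ∉ S → t ∈ S →
            (Adj (complement G) u t → Adj (complement G) v t) → Adj G v t → Adj G u t
  reflect u∉S v∉S t∈S imp v~t = decidable-stable (adj? G _ _) λ ¬u~t →
    Adj-complement⁻ G (x∉p∧y∈p⇒x≢y v∉S t∈S)
      (imp (Adj-complement⁺ G (x∉p∧y∈p⇒x≢y u∉S t∈S) ¬u~t)) v~t

CoDominating : Graph n → Subset n → Set
CoDominating G S = ∀ x → x ∉ S → ∃ λ z → z ∈ S × ¬ Adj G x z

CoDominating⇒Dominating-complement : (G : Graph n) {S : Subset n} →
                                     CoDominating G S → Dominating (complement G) S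
CoDominating⇒Dominating-complement G co x x∉S =
  let (z , z∈S , ¬x~z) = co x x∉S in z , z∈S , Adj-complement⁺ G (x∉p∧y∈p⇒x≢y x∉S z∈S) ¬x~z

AdjacentToAll : Graph n → Subset n → Fin n → Set
AdjacentToAll G T x = ∀ z → z ∈ T → Adj G x z

adjacentToAll? : (G : Graph n) (T : Subset n) → ∀ x → Dec (AdjacentToAll G T x)
adjacentToAll? G T x = all? λ z → z ∈? T →-dec adj? G x z

¬AdjacentToAll⇒∃nonNeighbour : (G : Graph n) (T : Subset n) {x : Fin n} →
                               ¬ AdjacentToAll G T x → ∃ λ z → z ∈ T × ¬ Adj G x z
¬AdjacentToAll⇒∃nonNeighbour G T {x} ¬all
  with z , ¬[z∈T→x~z] ← ¬∀⟶∃¬ _ _ (λ z → z ∈? T →-dec adj? G x z) ¬all =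
  z , decidable-stable (z ∈? T) (λ z∉T → ¬[z∈T→x~z] (λ z∈T → contradiction z∈T z∉T))
    , λ x~z → ¬[z∈T→x~z] (λ _ → x~z)

CoDominating⊎∃AdjacentToAll : (G : Graph n) (T : Subset n) →
                              CoDominating G T ⊎ ∃ λ x → x ∉ T × AdjacentToAll G T x
CoDominating⊎∃AdjacentToAll G T with any? (λ x → ¬? (x ∈? T) ×-dec adjacentToAll? G T x)
... | yes found = inj₂ found
... | no none   = inj₁ λ x x∉T → ¬AdjacentToAll⇒∃nonNeighbour G T (λ all → none (x , x∉T , all))

Adj-sym : (G : Graph n) {x y : Fin n} → Adj G x y → Adj G y x
Adj-sym G {x} {y} x~y = trans (Graph.sym G y x) x~y

AdjacentToAll⇒SameTrace : (G : Graph n) {T : Subset n} {x y : Fin n} →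
                          AdjacentToAll G T x → AdjacentToAll G T y → SameTrace G T x y
AdjacentToAll⇒SameTrace G x~T y~T z z∈T = (λ _ → y~T z z∈T) , (λ _ → x~T z z∈T)

module Exchange {G : Graph n} {A B T : Subset n}
  (A-stable : Stable G A) (B-stable : Stable G B) (∉A⇒∈B : ∀ {y} → y ∉ A → y ∈ B)
  (T-dom : Dominating G T) {x : Fin n} (x∈A : x ∈ A) (x∉T : x ∉ T) (x~T : AdjacentToAll G T x)
  where

  ∈T⇒∉A : ∀ {y} → y ∈ T → y ∉ A
  ∈T⇒∉A {y} y∈T y∈A = A-stable x y x∈A y∈A (x~T y y∈T)

  ∉A⇒∈T : ∀ {y} → y ∉ A → y ∈ T
  ∉A⇒∈T {y} y∉A = decidable-stable (y ∈? T) λ y∉T →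
    let (z , z∈T , y~z) = T-dom y y∉T in B-stable y z (∉A⇒∈B y∉A) (∉A⇒∈B (∈T⇒∉A z∈T)) y~z

  module _ {w : Fin n} (w∈T : w ∈ T) where

    S : Subset n
    S = exchange T w x

    x∈S : x ∈ S
    x∈S = x∈exchange T

    ∈S : ∀ {y} → y ∈ T → y ≢ w → y ∈ S
    ∈S y∈T y≢w = exchange-∈⁺ T y≢w (x∉p∧y∈p⇒x≢y x∉T y∈T ∘ sym) y∈T

    ∉S⇒≡w⊎∈A : ∀ {y} → y ∉ S → y ≡ w ⊎ (y ∈ A × y ≢ x)
    ∉S⇒≡w⊎∈A {y} y∉S with y ≟ w
    ... | yes y≡w = inj₁ y≡w
    ... | no y≢w  = inj₂ (decidable-stable (y ∈? A) (λ y∉A → y∉S (∈S (∉A⇒∈T y∉A) y≢w))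
                         , x∉p∧y∈p⇒x≢y y∉S x∈S)

    coDominating : ∀ {v} → v ∈ T → v ≢ w → CoDominating G S
    coDominating {v} v∈T v≢w y y∉S with ∉S⇒≡w⊎∈A y∉S
    ... | inj₁ refl       =
      v , ∈S v∈T v≢w , B-stable y v (∉A⇒∈B (∈T⇒∉A w∈T)) (∉A⇒∈B (∈T⇒∉A v∈T))
    ... | inj₂ (y∈A , _) = x , x∈S , A-stable y x y∈A x∈A

    distinguishing : (∀ {a a′} → a ∈ A → a′ ∈ A → a ≢ x → a′ ≢ x → SameTrace G S a a′ → a ≡ a′) →
                     Distinguishing G S
    distinguishing A-sep y z y∉S z∉S y≢z same with ∉S⇒≡w⊎∈A y∉S | ∉S⇒≡w⊎∈A z∉S
    ... | inj₁ refl         | inj₁ refl         = y≢z refl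
    ... | inj₁ refl         | inj₂ (z∈A , _)   =
      A-stable z x z∈A x∈A (proj₁ (same x x∈S) (Adj-sym G (x~T y w∈T)))
    ... | inj₂ (y∈A , _)   | inj₁ refl         =
      A-stable y x y∈A x∈A (proj₂ (same x x∈S) (Adj-sym G (x~T z w∈T)))
    ... | inj₂ (y∈A , y≢x) | inj₂ (z∈A , z≢x) = y≢z (A-sep y∈A z∈A y≢x z≢x same)

    complementLD : ∀ {v} → v ∈ T → v ≢ w →
                   (∀ {a a′} → a ∈ A → a′ ∈ A → a ≢ x → a′ ≢ x → SameTrace G S a a′ → a ≡ a′) →
                   ∃ λ S → LocatingDominating (complement G) S × ∣ S ∣ ≡ ∣ T ∣
    complementLD v∈T v≢w A-sep =
      S , (Distinguishing-complement G (distinguishing A-sep)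
          , CoDominating⇒Dominating-complement G (coDominating v∈T v≢w))
        , ∣exchange∣ T w∈T x∉T

module _ {G : Graph n} {U T : Subset n} (U-stable : Stable G U) (W-stable : Stable G (∁ U))
         (∣U∣≤2 : ∣ U ∣ ≤ 2) (2≤∣W∣ : 2 ≤ ∣ ∁ U ∣)
         {x : Fin n} (x∉T : x ∉ T) (x~T : AdjacentToAll G T x)
  where

  complementLD-x∈U : Dominating G T → x ∈ U →
                     ∃ λ S → LocatingDominating (complement G) S × ∣ S ∣ ≡ ∣ T ∣
  complementLD-x∈U T-dom x∈U =
    let (w , w∈T , _)     = T-dom x x∉T
        (v , v∈W , v≢w) = 2≤∣p∣⇒∃x∈p∧x≢y (∁ U) 2≤∣W∣ w
    in complementLD w∈T (∉A⇒∈T (x∈∁p⇒x∉p v∈W)) v≢w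
         λ a∈U a′∈U a≢x a′≢x _ → at-most-one-other a∈U a′∈U a≢x a′≢x
    where
    open Exchange {G = G} U-stable W-stable x∉p⇒x∈∁p T-dom x∈U x∉T x~T
    at-most-one-other : ∀ {a a′} → a ∈ U → a′ ∈ U → a ≢ x → a′ ≢ x → a ≡ a′
    at-most-one-other a∈U a′∈U a≢x a′≢x with ∣p∣≤2⇒x≡y⊎x≡z ∣U∣≤2 x∈U a∈U (a≢x ∘ sym) a′∈U
    ... | inj₁ a′≡x = contradiction a′≡x a′≢x
    ... | inj₂ a′≡a = sym a′≡a

  complementLD-x∉U : LocatingDominating G T → x ∉ U →
                     ∃ λ S → LocatingDominating (complement G) S × ∣ S ∣ ≡ ∣ T ∣
  complementLD-x∉U (T-dist , T-dom) x∉U =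
    let (y , y∈W , y≢x)  = 2≤∣p∣⇒∃x∈p∧x≢y (∁ U) 2≤∣W∣ x
        (p , p∈T , y~p)  = T-dom y (∉T y∈W)
        (q , q∈T , y≁q) = ¬AdjacentToAll⇒∃nonNeighbour G T (¬AdjacentToAll y∈W y≢x)
        q≢p : q ≢ p
        q≢p q≡p = y≁q (subst (Adj G y) (sym q≡p) y~p)
    in complementLD p∈T q∈T q≢p (separated p∈T q∈T q≢p)
    where
    open Exchange {G = G} W-stable U-stable x∉∁p⇒x∈p T-dom (x∉p⇒x∈∁p x∉U) x∉T x~T

    ∉T : ∀ {y} → y ∈ ∁ U → y ∉ T
    ∉T y∈W y∈T = ∈T⇒∉A y∈T y∈W

    ¬AdjacentToAll : ∀ {y} → y ∈ ∁ U → y ≢ x → ¬ AdjacentToAll G T y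
    ¬AdjacentToAll y∈W y≢x y~T =
      T-dist x _ x∉T (∉T y∈W) (y≢x ∘ sym) (AdjacentToAll⇒SameTrace G x~T y~T)

    -- T = U = {p, q}, and every vertex of W other than x is adjacent to exactly one of p and q.
    module _ {p q : Fin n} (p∈T : p ∈ T) (q∈T : q ∈ T) (q≢p : q ≢ p) where

      ≡p⊎≡q : ∀ {t} → t ∈ T → t ≡ p ⊎ t ≡ q
      ≡p⊎≡q t∈T = ∣p∣≤2⇒x≡y⊎x≡z ∣U∣≤2 (x∉∁p⇒x∈p (∈T⇒∉A p∈T)) (x∉∁p⇒x∈p (∈T⇒∉A q∈T))
                                 (q≢p ∘ sym) (x∉∁p⇒x∈p (∈T⇒∉A t∈T))

      on-T : (P : Fin n → Set) → P p → P q → ∀ {t} → t ∈ T → P t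
      on-T P Pp Pq t∈T with ≡p⊎≡q t∈T
      ... | inj₁ refl = Pp
      ... | inj₂ refl = Pq

      ~p⇒≁q : ∀ {y} → y ∈ ∁ U → y ≢ x → Adj G y p → ¬ Adj G y q
      ~p⇒≁q {y} y∈W y≢x y~p y~q = ¬AdjacentToAll y∈W y≢x λ _ → on-T (Adj G y) y~p y~q

      ≁q⇒~p : ∀ {y} → y ∈ ∁ U → ¬ Adj G y q → Adj G y p
      ≁q⇒~p {y} y∈W y≁q =
        let (t , t∈T , y~t) = T-dom y (∉T y∈W)
        in on-T (λ t → Adj G y t → Adj G y p) (λ y~p → y~p) (λ y~q → contradiction y~q y≁q)
                t∈T y~t

      ~p-transfer : ∀ {y y′} → y ∈ ∁ U → y′ ∈ ∁ U → y ≢ x →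
                    (Adj G y′ q → Adj G y q) → Adj G y p → Adj G y′ p
      ~p-transfer y∈W y′∈W y≢x y′~q⇒y~q y~p = ≁q⇒~p y′∈W (~p⇒≁q y∈W y≢x y~p ∘ y′~q⇒y~q)

      separated : ∀ {a a′} → a ∈ ∁ U → a′ ∈ ∁ U → a ≢ x → a′ ≢ x →
                  SameTrace G (S p∈T) a a′ → a ≡ a′
      separated {a} {a′} a∈W a′∈W a≢x a′≢x same =
        decidable-stable (a ≟ a′) λ a≢a′ → T-dist a a′ (∉T a∈W) (∉T a′∈W) a≢a′ λ t t∈T →
          on-T (λ t → (Adj G a t → Adj G a′ t) × (Adj G a′ t → Adj G a t))
               ( ~p-transfer a∈W a′∈W a≢x (proj₂ (same q q∈S))
               , ~p-transfer a′∈W a∈W a′≢x (proj₁ (same q q∈S)))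
               (same q q∈S) t∈T
        where
        q∈S : q ∈ S p∈T
        q∈S = ∈S p∈T q∈T q≢p

complementLD-sameSize : (G : Graph n) (U : Subset n) {T : Subset n} →
                        IsBipartition G U → ∣ U ∣ ≤ 2 → 2 ≤ ∣ ∁ U ∣ → LocatingDominating G T →
                        ∃ λ S → LocatingDominating (complement G) S × ∣ S ∣ ≡ ∣ T ∣
complementLD-sameSize G U {T} (U-stable , W-stable) ∣U∣≤2 2≤∣W∣ T-ld@(T-dist , T-dom)
  with CoDominating⊎∃AdjacentToAll G T
... | inj₁ T-co =
  T , (Distinguishing-complement G T-dist , CoDominating⇒Dominating-complement G T-co) , refl
... | inj₂ (x , x∉T , x~T) with x ∈? U
...   | yes x∈U = complementLD-x∈U {G = G} {U} U-stable W-stable ∣U∣≤2 2≤∣W∣ x∉T x~T T-dom x∈U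
...   | no x∉U  = complementLD-x∉U {G = G} {U} U-stable W-stable ∣U∣≤2 2≤∣W∣ x∉T x~T T-ld x∉U

proposition14 : ∀ {n : ℕ} (G : Graph n) (U : Subset n) →
    4 ≤ n → Connected G → IsBipartition G U →
    ∣ U ∣ ≤ ∣ ∁ U ∣ → 1 ≤ ∣ U ∣ → ∣ U ∣ ≤ 2 →
    ∀ a b → IsLDNumber (complement G) a → IsLDNumber G b → a ≤ b
proposition14 G U 4≤n _ bipartite _ _ ∣U∣≤2 a b (_ , a-minimal) ((T , T-ld , ∣T∣≡b) , _) =
  let (S , S-ld , ∣S∣≡∣T∣) = complementLD-sameSize G U bipartite ∣U∣≤2 2≤∣W∣ T-ld
  in subst (a ≤_) (trans ∣S∣≡∣T∣ ∣T∣≡b) (a-minimal S S-ld)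
  where
  2≤∣W∣ : 2 ≤ ∣ ∁ U ∣
  2≤∣W∣ = subst (2 ≤_) (sym (∣∁p∣≡n∸∣p∣ U)) (∸-mono 4≤n ∣U∣≤2)
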